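{- Let $l\ge3$. For states $x,y$ of the lazy two-particle exclusion process on the star graph $G_l$, let $Q(x,y)$ be the expected hitting time of $y$ starting from $x$. Write $i$ for the state in which one particle is at the center and the other at leaf $i$, and $\{i,j\}$ for the state in which the particles occupy leaves $i$ and $j$. Then - $Q(\{1,2\},1)=l^2+2l$; - $Q(\{2,3\},1)=2l^2+3l$; - $Q(2,1)=2l^2+2l$; - $Q(1,\{1,2\})=\frac{l^3+l^2-2l}{2}$; - $Q(3,\{1,2\})=\frac{l^3+3l^2}{2}$; - $Q(\{1,3\},\{1,2\})=\frac{l^3+2l^2+l}{2}$; - $Q(\{3,4\},\{1,2\})=\frac{l^3+3l^2+2l}{2}$, this last identity holding whenever $l\ge4$, so that leaf $4$ exists.
   Context: The star graph $G_l$ has a center vertex $c$ of degree $l$ and leaves $1,\dots,l$. The lazy two-particle exclusion process on $G_l$ is a Markov chain $(X_t)$ on unordered pairs of distinct vertices. At each step, with probability $1/2$ nothing happens. Otherwise one of the $l$ edges is chosen uniformly; if exactly one endpoint is occupied, that particle moves across the edge, and otherwise nothing happens. The expected hitting time is $Q(x,y)=\mathbb{E}_x[\min\{t\ge0:X_t=y\}]$. -}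

module Defs where

open import Data.Nat as ℕ using (ℕ; zero; suc; _≤_; NonZero)
open import Data.Fin as Fin using (Fin; zero; suc; toℕ)
open import Data.Fin.Properties using (<-cmp) renaming (_≟_ to _≟ᶠ_)
open import Data.Integer using (+_)
open import Data.Rational using (ℚ; 0ℚ; 1ℚ; _/_; _+_; _*_; _-_; ∣_∣; _<_)
open import Data.Bool using (Bool; true; false; _∧_)
open import Data.Product using (Σ; ∃; _×_)
open import Relation.Nullary using (does)
open import Relation.Binary.Definitions using (tri<; tri≈; tri>)

-- Star graph G_l: centre c, leaves indexed by Fin l (leaf k+1 is Fin index k);
-- edge k joins c and leaf k.
-- States of the two-particle exclusion process = unordered pairs of distinct vertices:
--   cl i       : one particle at the centre, the other at leaf i   (the state "i")
--   ll i j p   : particles at leaves i and j, with i < j           (the state "{i,j}")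
data State (l : ℕ) : Set where
  cl : Fin l → State l
  ll : (i j : Fin l) → i Fin.< j → State l

leafPair : {l : ℕ} → Fin l → Fin l → State l
leafPair i j with <-cmp i j
... | tri< i<j _ _ = ll i j i<j
... | tri> _ _ j<i = ll j i j<i
... | tri≈ _ _ _   = cl i   -- never used: leaves are distinct

-- effect of choosing edge k (centre -- leaf k) in state x
move : {l : ℕ} → State l → Fin l → State l
move (cl i) k with does (i ≟ᶠ k)
... | true  = cl i              -- both endpoints occupied: nothing happens
... | false = leafPair i k
move (ll i j p) k with does (i ≟ᶠ k) | does (j ≟ᶠ k)
... | true  | _     = cl j
... | false | true  = cl i
... | false | false = ll i j p  -- neither endpoint occupied: nothing happens

sameState : {l : ℕ} → State l → State l → Bool
sameState (cl i) (cl i') = does (i ≟ᶠ i')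
sameState (cl _) (ll _ _ _) = false
sameState (ll _ _ _) (cl _) = false
sameState (ll i j _) (ll i' j' _) = does (i ≟ᶠ i') ∧ does (j ≟ᶠ j')

sumFin : (n : ℕ) → (Fin n → ℚ) → ℚ
sumFin zero    f = 0ℚ
sumFin (suc n) f = f zero + sumFin n (λ k → f (suc k))

stepOp : (l : ℕ) → .{{NonZero l}} → (State l → ℚ) → State l → ℚ
stepOp l f x = ((+ 1 / 2) * f x) + ((+ 1 / 2) * (+ 1 / l) * sumFin l (λ k → f (move x k)))

indicatorNot : {l : ℕ} → State l → State l → ℚ
indicatorNot y x with sameState x y
... | true  = 0ℚ
... | false = 1ℚ

-- survival x t = P_x(τ_y > t), where τ_y = min{t ≥ 0 : X_t = y}
survival : (l : ℕ) → .{{NonZero l}} → State l → ℕ → State l → ℚ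
survival l y zero    x = indicatorNot y x
survival l y (suc t) x = indicatorNot y x * stepOp l (survival l y t) x

partialSum : (l : ℕ) → .{{NonZero l}} → State l → State l → ℕ → ℚ
partialSum l x y zero    = 0ℚ
partialSum l x y (suc T) = partialSum l x y T + survival l y T x

-- Q(x,y) = q : E_x[τ_y] = Σ_{t≥0} P_x(τ_y > t) converges (in ℚ) to q
-- (this also covers τ_y = ∞ with positive probability: then the series diverges)
HittingTime : (l : ℕ) → .{{NonZero l}} → State l → State l → ℚ → Set
HittingTime l x y q =
  ∀ (ε : ℚ) → 0ℚ < ε → ∃ λ (N : ℕ) → ∀ (T : ℕ) → N ≤ T → ∣ partialSum l x y T - q ∣ < ε

ℕ→ℚ : ℕ → ℚ
ℕ→ℚ n = + n / 1

half : ℚ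
half = + 1 / 2

-- The key general fact
-- (module Absorption.HittingEquation) is: if h ≥ 0 solves the first-step equation
-- h = 𝟙[·≠y] · (1 + P h), and a·h ≤ 𝟙[·≠y] for some 0 < a ≤ 1, then h(x) minus the
-- T-th partial sum is the T-fold killed chain applied to h, which is at most
-- (1-a)ᵀ h(x); a Bernoulli inequality and the Archimedean property make this small.
-- Such solutions are produced as halves of integer potentials H, i.e. functions with
-- H(y) = 0 and l·H(x) = 4l + Σ_k H(x after edge k) off y (potential-hittingTime).
-- For the targets "1" (TargetCentre) and {1,2} (TargetPair) the potential is written
-- down explicitly: by the symmetry of the star it only depends on how a state meets
-- the target, the neighbour values form a constant function with two or three
-- exceptions, and each equation becomes one polynomial identity in l.
module Submission where

open import Defs
open import Data.Nat as ℕ using (ℕ; zero; suc; z≤n; s≤s)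
import Data.Nat.Properties as ℕP
open import Algebra.Properties.CommutativeSemigroup ℕP.+-commutativeSemigroup using (xy∙z≈xz∙y)
open import Data.Integer as ℤ using (+_)
import Data.Integer.Properties as ℤP
open import Data.Rational
  using (ℚ; 0ℚ; 1ℚ; mkℚ; _+_; _*_; _-_; -_; _/_; _≤_; _<_; ∣_∣; *≤*; *<*; toℚᵘ; nonNegative; positive)
open import Data.Rational.Properties hiding (_≟_; <⇒≢; <-cmp)
open import Data.Rational.Unnormalised as ℚᵘ using (mkℚᵘ; *≡*) renaming (_≃_ to _≃ᵘ_)
import Data.Rational.Unnormalised.Properties as ℚᵘP
open import Data.Rational.Solver using () renaming (module +-*-Solver to ℚ-Solver)
open import Data.Nat.Solver using () renaming (module +-*-Solver to ℕ-Solver)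
open import Data.Fin using (Fin; zero; suc)
open import Data.Fin.Properties using (_≟_; suc-injective; <⇒≢; <-cmp)
open import Data.Product using (∃; _,_; _×_)
open import Data.Bool using (true; false; if_then_else_)
open import Data.Sum using (_⊎_; inj₁; inj₂)
open import Data.Empty using (⊥-elim)
open import Relation.Nullary using (does; yes; no)
open import Relation.Binary.Definitions using (tri<; tri≈; tri>)
open import Relation.Binary.PropositionalEquality

toℚᵘ-ℕ→ℚ : ∀ n → toℚᵘ (ℕ→ℚ n) ≃ᵘ mkℚᵘ (+ n) 0
toℚᵘ-ℕ→ℚ n = toℚᵘ-fromℚᵘ (mkℚᵘ (+ n) 0)

ℕ→ℚ-+ : ∀ m n → ℕ→ℚ (m ℕ.+ n) ≡ ℕ→ℚ m + ℕ→ℚ n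
ℕ→ℚ-+ m n = toℚᵘ-injective (begin
    toℚᵘ (ℕ→ℚ (m ℕ.+ n))             ≈⟨ toℚᵘ-ℕ→ℚ (m ℕ.+ n) ⟩
    mkℚᵘ (+ (m ℕ.+ n)) 0              ≈⟨ *≡* (cong (ℤ._* + 1) (trans (ℤP.pos-+ m n)
                                        (sym (cong₂ ℤ._+_ (ℤP.*-identityʳ (+ m)) (ℤP.*-identityʳ (+ n)))))) ⟩
    mkℚᵘ (+ m) 0 ℚᵘ.+ mkℚᵘ (+ n) 0    ≈⟨ ℚᵘP.+-cong (toℚᵘ-ℕ→ℚ m) (toℚᵘ-ℕ→ℚ n) ⟨
    toℚᵘ (ℕ→ℚ m) ℚᵘ.+ toℚᵘ (ℕ→ℚ n)    ≈⟨ toℚᵘ-homo-+ (ℕ→ℚ m) (ℕ→ℚ n) ⟨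
    toℚᵘ (ℕ→ℚ m + ℕ→ℚ n)              ∎)
  where open ℚᵘP.≃-Reasoning

ℕ→ℚ-* : ∀ m n → ℕ→ℚ (m ℕ.* n) ≡ ℕ→ℚ m * ℕ→ℚ n
ℕ→ℚ-* m n = toℚᵘ-injective (begin
    toℚᵘ (ℕ→ℚ (m ℕ.* n))             ≈⟨ toℚᵘ-ℕ→ℚ (m ℕ.* n) ⟩
    mkℚᵘ (+ (m ℕ.* n)) 0              ≈⟨ *≡* (cong (ℤ._* + 1) (ℤP.pos-* m n)) ⟩
    mkℚᵘ (+ m) 0 ℚᵘ.* mkℚᵘ (+ n) 0    ≈⟨ ℚᵘP.*-cong (toℚᵘ-ℕ→ℚ m) (toℚᵘ-ℕ→ℚ n) ⟨
    toℚᵘ (ℕ→ℚ m) ℚᵘ.* toℚᵘ (ℕ→ℚ n)    ≈⟨ toℚᵘ-homo-* (ℕ→ℚ m) (ℕ→ℚ n) ⟨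
    toℚᵘ (ℕ→ℚ m * ℕ→ℚ n)              ∎)
  where open ℚᵘP.≃-Reasoning

ℕ→ℚ-mono-≤ : ∀ {m n} → m ℕ.≤ n → ℕ→ℚ m ≤ ℕ→ℚ n
ℕ→ℚ-mono-≤ {m} {n} m≤n = toℚᵘ-cancel-≤ (begin
    toℚᵘ (ℕ→ℚ m)    ≃⟨ toℚᵘ-ℕ→ℚ m ⟩
    mkℚᵘ (+ m) 0    ≤⟨ ℚᵘ.*≤* (ℤP.*-monoʳ-≤-nonNeg (+ 1) (ℤ.+≤+ m≤n)) ⟩
    mkℚᵘ (+ n) 0    ≃⟨ toℚᵘ-ℕ→ℚ n ⟨
    toℚᵘ (ℕ→ℚ n)    ∎)
  where open ℚᵘP.≤-Reasoning

ℕ→ℚ-nonNeg : ∀ n → 0ℚ ≤ ℕ→ℚ n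
ℕ→ℚ-nonNeg n = ℕ→ℚ-mono-≤ (z≤n {n})

cubic : ℕ → ℕ → ℕ → ℕ → ℕ
cubic a b c l = a ℕ.* l ℕ.* l ℕ.* l ℕ.+ b ℕ.* l ℕ.* l ℕ.+ c ℕ.* l

ℕ→ℚ-cubic : ∀ a b c l → let λ′ = ℕ→ℚ l in
            ℕ→ℚ (cubic a b c l) ≡ ℕ→ℚ a * λ′ * λ′ * λ′ + ℕ→ℚ b * λ′ * λ′ + ℕ→ℚ c * λ′
ℕ→ℚ-cubic a b c l = begin
    ℕ→ℚ (a ℕ.* l ℕ.* l ℕ.* l ℕ.+ b ℕ.* l ℕ.* l ℕ.+ c ℕ.* l)
  ≡⟨ trans (ℕ→ℚ-+ (a ℕ.* l ℕ.* l ℕ.* l ℕ.+ b ℕ.* l ℕ.* l) (c ℕ.* l))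
           (cong (_+ ℕ→ℚ (c ℕ.* l)) (ℕ→ℚ-+ (a ℕ.* l ℕ.* l ℕ.* l) (b ℕ.* l ℕ.* l))) ⟩
    ℕ→ℚ (a ℕ.* l ℕ.* l ℕ.* l) + ℕ→ℚ (b ℕ.* l ℕ.* l) + ℕ→ℚ (c ℕ.* l)
  ≡⟨ cong₂ _+_ (cong₂ _+_ (monomial a 3) (monomial b 2)) (monomial c 1) ⟩
    ℕ→ℚ a * λ′ * λ′ * λ′ + ℕ→ℚ b * λ′ * λ′ + ℕ→ℚ c * λ′ ∎
  where
  open ≡-Reasoning
  λ′ = ℕ→ℚ l
  times-l : ℕ → ℕ → ℕ
  times-l a zero    = a
  times-l a (suc k) = times-l a k ℕ.* l
  times-λ : ℚ → ℕ → ℚ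
  times-λ q zero    = q
  times-λ q (suc k) = times-λ q k * λ′
  monomial : ∀ a k → ℕ→ℚ (times-l a k) ≡ times-λ (ℕ→ℚ a) k
  monomial a zero    = refl
  monomial a (suc k) = trans (ℕ→ℚ-* (times-l a k) l) (cong (_* λ′) (monomial a k))

1/suc-inverse : ∀ n → (+ 1 / suc n) * ℕ→ℚ (suc n) ≡ 1ℚ
1/suc-inverse n = toℚᵘ-injective (begin
    toℚᵘ ((+ 1 / suc n) * ℕ→ℚ (suc n))              ≈⟨ toℚᵘ-homo-* (+ 1 / suc n) (ℕ→ℚ (suc n)) ⟩
    toℚᵘ (+ 1 / suc n) ℚᵘ.* toℚᵘ (ℕ→ℚ (suc n))     ≈⟨ ℚᵘP.*-cong (toℚᵘ-fromℚᵘ (mkℚᵘ (+ 1) n)) (toℚᵘ-ℕ→ℚ (suc n)) ⟩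
    mkℚᵘ (+ 1) n ℚᵘ.* mkℚᵘ (+ suc n) 0               ≈⟨ *≡* (trans (ℤP.*-identityʳ _) (trans (ℤP.*-identityˡ _)
                                                          (sym (trans (ℤP.*-identityˡ _) (cong +_ (ℕP.*-identityʳ (suc n))))))) ⟩
    toℚᵘ 1ℚ                                           ∎)
  where open ℚᵘP.≃-Reasoning

-- Archimedean property: finitely many copies of a positive rational exceed 1.
-- For δ = (p+1)/(q+1) the choice N = q+2 works, since N(p+1) > q+1.
archimedean : ∀ δ → 0ℚ < δ → ∃ λ N → 1ℚ < ℕ→ℚ N * δ
archimedean (mkℚ (+ 0) _ _) (*<* (ℤ.+<+ ()))
archimedean δ@(mkℚ ℤ.+[1+ p ] q _) _ = N , toℚᵘ-cancel-< (begin-strict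
    toℚᵘ 1ℚ                                   <⟨ ℚᵘ.*<* (subst₂ ℤ._<_ (sym crossˡ) (sym crossʳ) (ℤ.+<+ N>q+1)) ⟩
    mkℚᵘ (+ N) 0 ℚᵘ.* mkℚᵘ ℤ.+[1+ p ] q       ≃⟨ ℚᵘP.*-congʳ (toℚᵘ-ℕ→ℚ N) ⟨
    toℚᵘ (ℕ→ℚ N) ℚᵘ.* toℚᵘ δ                  ≃⟨ toℚᵘ-homo-* (ℕ→ℚ N) δ ⟨
    toℚᵘ (ℕ→ℚ N * δ)                          ∎)
  where
  open ℚᵘP.≤-Reasoning
  N : ℕ
  N = suc (suc q)
  crossˡ : + 1 ℤ.* ℚᵘ.↧ (mkℚᵘ (+ N) 0 ℚᵘ.* mkℚᵘ ℤ.+[1+ p ] q) ≡ + suc q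
  crossˡ = trans (ℤP.*-identityˡ _) (cong (λ k → + suc k) (ℕP.+-identityʳ q))
  crossʳ : ℚᵘ.↥ (mkℚᵘ (+ N) 0 ℚᵘ.* mkℚᵘ ℤ.+[1+ p ] q) ℤ.* + 1 ≡ + (N ℕ.* suc p)
  crossʳ = trans (ℤP.*-identityʳ _) (sym (ℤP.pos-* N (suc p)))
  N>q+1 : suc q ℕ.< N ℕ.* suc p
  N>q+1 = ℕP.m≤m*n N (suc p)

*-nonNeg : ∀ {p q} → 0ℚ ≤ p → 0ℚ ≤ q → 0ℚ ≤ p * q
*-nonNeg {p} {q} 0≤p 0≤q =
  nonNegative⁻¹ _ {{nonNeg*nonNeg⇒nonNeg p {{nonNegative 0≤p}} q {{nonNegative 0≤q}}}}

+-nonNeg : ∀ {p q} → 0ℚ ≤ p → 0ℚ ≤ q → 0ℚ ≤ p + q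
+-nonNeg = +-mono-≤

*-monoˡ-≤ : ∀ {r p q} → 0ℚ ≤ r → p ≤ q → r * p ≤ r * q
*-monoˡ-≤ {r} 0≤r = *-monoˡ-≤-nonNeg r {{nonNegative 0≤r}}

*-monoʳ-≤ : ∀ {r p q} → 0ℚ ≤ r → p ≤ q → p * r ≤ q * r
*-monoʳ-≤ {r} 0≤r = *-monoʳ-≤-nonNeg r {{nonNegative 0≤r}}

p≤q⇒0≤q-p : ∀ {p q} → p ≤ q → 0ℚ ≤ q - p
p≤q⇒0≤q-p {p} {q} p≤q = subst (_≤ q - p) (+-inverseʳ p) (+-monoˡ-≤ (- p) p≤q)

p≤q+p : ∀ {p q} → 0ℚ ≤ q → p ≤ q + p
p≤q+p {p} {q} 0≤q = subst (_≤ q + p) (+-identityˡ p) (+-monoˡ-≤ p 0≤q)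

p-q≤p : ∀ {p q} → 0ℚ ≤ q → p - q ≤ p
p-q≤p {p} 0≤q = subst (p - _ ≤_) (+-identityʳ p) (+-monoʳ-≤ p (neg-antimono-≤ 0≤q))

0≤1 : 0ℚ ≤ 1ℚ
0≤1 = *≤* (ℤ.+≤+ z≤n)

0≤half : 0ℚ ≤ half
0≤half = *≤* (ℤ.+≤+ z≤n)

_^_ : ℚ → ℕ → ℚ
r ^ zero  = 1ℚ
r ^ suc n = r * r ^ n

^-nonNeg : ∀ {r} → 0ℚ ≤ r → ∀ n → 0ℚ ≤ r ^ n
^-nonNeg 0≤r zero    = 0≤1
^-nonNeg 0≤r (suc n) = *-nonNeg 0≤r (^-nonNeg 0≤r n)

^-antitone : ∀ {r m n} → 0ℚ ≤ r → r ≤ 1ℚ → m ℕ.≤ n → r ^ n ≤ r ^ m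
^-antitone {r} {m} 0≤r r≤1 m≤n = go (ℕP.≤⇒≤′ m≤n)
  where
  go : ∀ {n} → m ℕ.≤′ n → r ^ n ≤ r ^ m
  go ℕ.≤′-refl                = ≤-refl
  go (ℕ.≤′-step {n} m≤′n) = ≤-trans step (go m≤′n)
    where
    step : r * r ^ n ≤ r ^ n
    step = subst (r * r ^ n ≤_) (*-identityˡ (r ^ n)) (*-monoʳ-≤ (^-nonNeg 0≤r n) r≤1)

-- Bernoulli: for 0 ≤ a ≤ 1, (1 - a)ⁿ (1 + n a) ≤ 1, so (1 - a)ⁿ decays like 1/(n a).
bernoulli : ∀ {a} → 0ℚ ≤ a → a ≤ 1ℚ → ∀ n → (1ℚ - a) ^ n * (1ℚ + ℕ→ℚ n * a) ≤ 1ℚ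
bernoulli {a} 0≤a a≤1 zero = ≤-reflexive (solve 1 (λ a → con 1ℚ :* (con 1ℚ :+ con 0ℚ :* a) := con 1ℚ) refl a)
  where open ℚ-Solver
bernoulli {a} 0≤a a≤1 (suc n) = begin
    (1ℚ - a) ^ suc n * (1ℚ + ℕ→ℚ (suc n) * a)
  ≡⟨ cong (λ k → (1ℚ - a) ^ suc n * (1ℚ + k * a)) (ℕ→ℚ-+ 1 n) ⟩
    ((1ℚ - a) * ρⁿ) * (1ℚ + (1ℚ + ν) * a)
  ≡⟨ solve 3 (λ ρⁿ ν a → ((con 1ℚ :- a) :* ρⁿ) :* (con 1ℚ :+ (con 1ℚ :+ ν) :* a)
                       := ρⁿ :* ((con 1ℚ :+ ν :* a) :- a :* a :* (con 1ℚ :+ ν))) refl ρⁿ ν a ⟩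
    ρⁿ * ((1ℚ + ν * a) - a * a * (1ℚ + ν))
  ≤⟨ *-monoˡ-≤ (^-nonNeg (p≤q⇒0≤q-p a≤1) n) (p-q≤p (*-nonNeg (*-nonNeg 0≤a 0≤a) (+-nonNeg 0≤1 (ℕ→ℚ-nonNeg n)))) ⟩
    ρⁿ * (1ℚ + ν * a)
  ≤⟨ bernoulli 0≤a a≤1 n ⟩
    1ℚ ∎
  where
  open ≤-Reasoning
  open ℚ-Solver
  ρⁿ = (1ℚ - a) ^ n
  ν  = ℕ→ℚ n

sumFin-cong : ∀ n {f g : Fin n → ℚ} → (∀ k → f k ≡ g k) → sumFin n f ≡ sumFin n g
sumFin-cong zero    f≡g = refl
sumFin-cong (suc n) f≡g = cong₂ _+_ (f≡g zero) (sumFin-cong n (λ k → f≡g (suc k)))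

sumFin-+ : ∀ n (f g : Fin n → ℚ) → sumFin n (λ k → f k + g k) ≡ sumFin n f + sumFin n g
sumFin-+ zero    f g = refl
sumFin-+ (suc n) f g = trans (cong (_+_ (f zero + g zero)) (sumFin-+ n (λ k → f (suc k)) (λ k → g (suc k))))
  (solve 4 (λ a b c d → (a :+ b) :+ (c :+ d) := (a :+ c) :+ (b :+ d)) refl (f zero) (g zero) _ _)
  where open ℚ-Solver

sumFin-* : ∀ n c (f : Fin n → ℚ) → sumFin n (λ k → c * f k) ≡ c * sumFin n f
sumFin-* zero    c f = sym (*-zeroʳ c)
sumFin-* (suc n) c f = trans (cong (_+_ (c * f zero)) (sumFin-* n c (λ k → f (suc k)))) (sym (*-distribˡ-+ c _ _))

sumFin-mono : ∀ n {f g : Fin n → ℚ} → (∀ k → f k ≤ g k) → sumFin n f ≤ sumFin n g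
sumFin-mono zero    f≤g = ≤-refl
sumFin-mono (suc n) f≤g = +-mono-≤ (f≤g zero) (sumFin-mono n (λ k → f≤g (suc k)))

sumFin-nonNeg : ∀ n {f : Fin n → ℚ} → (∀ k → 0ℚ ≤ f k) → 0ℚ ≤ sumFin n f
sumFin-nonNeg zero    0≤f = ≤-refl
sumFin-nonNeg (suc n) 0≤f = +-nonNeg (0≤f zero) (sumFin-nonNeg n (λ k → 0≤f (suc k)))

sumℕ : (n : ℕ) → (Fin n → ℕ) → ℕ
sumℕ zero    f = 0
sumℕ (suc n) f = f zero ℕ.+ sumℕ n (λ k → f (suc k))

sumFin-ℕ→ℚ : ∀ n (f : Fin n → ℕ) → sumFin n (λ k → ℕ→ℚ (f k)) ≡ ℕ→ℚ (sumℕ n f)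
sumFin-ℕ→ℚ zero    f = refl
sumFin-ℕ→ℚ (suc n) f =
  trans (cong (_+_ (ℕ→ℚ (f zero))) (sumFin-ℕ→ℚ n (λ k → f (suc k)))) (sym (ℕ→ℚ-+ (f zero) _))

-- The chain killed at a target state y

module Absorption (l : ℕ) .{{_ : ℕ.NonZero l}} (y : State l) where
  open ℚ-Solver

  alive : State l → ℚ
  alive = indicatorNot y

  alive-nonNeg : ∀ x → 0ℚ ≤ alive x
  alive-nonNeg x with sameState x y
  ... | true  = ≤-refl
  ... | false = 0≤1

  alive-≤1 : ∀ x → alive x ≤ 1ℚ
  alive-≤1 x with sameState x y
  ... | true  = 0≤1
  ... | false = ≤-refl

  -- Each of the l edge moves has probability 1/(2l).
  edgeWeight : ℚ
  edgeWeight = half * (+ 1 / l)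

  0≤edgeWeight : 0ℚ ≤ edgeWeight
  0≤edgeWeight = *-nonNeg 0≤half (nonNegative⁻¹ (+ 1 / l) {{normalize-nonNeg 1 l}})

  stepOp-cong : ∀ {f g} → (∀ z → f z ≡ g z) → ∀ x → stepOp l f x ≡ stepOp l g x
  stepOp-cong f≡g x = cong₂ (λ u s → half * u + edgeWeight * s) (f≡g x) (sumFin-cong l (λ k → f≡g (move x k)))

  stepOp-+ : ∀ f g x → stepOp l (λ z → f z + g z) x ≡ stepOp l f x + stepOp l g x
  stepOp-+ f g x = trans (cong (λ s → half * (f x + g x) + edgeWeight * s) (sumFin-+ l _ _))
    (solve 6 (λ h w a b s t → h :* (a :+ b) :+ w :* (s :+ t) := (h :* a :+ w :* s) :+ (h :* b :+ w :* t))
           refl half edgeWeight (f x) (g x) _ _)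

  stepOp-* : ∀ c f x → stepOp l (λ z → c * f z) x ≡ c * stepOp l f x
  stepOp-* c f x = trans (cong (λ s → half * (c * f x) + edgeWeight * s) (sumFin-* l c _))
    (solve 5 (λ h w c a s → h :* (c :* a) :+ w :* (c :* s) := c :* (h :* a :+ w :* s)) refl half edgeWeight c (f x) _)

  stepOp-mono : ∀ {f g} → (∀ z → f z ≤ g z) → ∀ x → stepOp l f x ≤ stepOp l g x
  stepOp-mono f≤g x =
    +-mono-≤ (*-monoˡ-≤ 0≤half (f≤g x)) (*-monoˡ-≤ 0≤edgeWeight (sumFin-mono l (λ k → f≤g (move x k))))

  stepOp-nonNeg : ∀ {f} → (∀ z → 0ℚ ≤ f z) → ∀ x → 0ℚ ≤ stepOp l f x
  stepOp-nonNeg 0≤f x =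
    +-nonNeg (*-nonNeg 0≤half (0≤f x)) (*-nonNeg 0≤edgeWeight (sumFin-nonNeg l (λ k → 0≤f (move x k))))

  -- One step of the killed chain: survival l y (T+1) = killed (survival l y T).
  killed : (State l → ℚ) → State l → ℚ
  killed f x = alive x * stepOp l f x

  killed-* : ∀ c f x → killed (λ z → c * f z) x ≡ c * killed f x
  killed-* c f x = trans (cong (alive x *_) (stepOp-* c f x))
    (solve 3 (λ i c s → i :* (c :* s) := c :* (i :* s)) refl (alive x) c _)

  killedⁿ : ℕ → (State l → ℚ) → State l → ℚ
  killedⁿ zero    f = f
  killedⁿ (suc T) f = killed (killedⁿ T f)

  module HittingEquation
    (h : State l → ℚ) (a : ℚ) (0<a : 0ℚ < a) (a≤1 : a ≤ 1ℚ)
    (h-equation : ∀ x → h x ≡ alive x + killed h x)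
    (h-nonNeg : ∀ x → 0ℚ ≤ h x)
    (h-bounded : ∀ x → a * h x ≤ alive x) where

    0≤a : 0ℚ ≤ a
    0≤a = <⇒≤ 0<a

    ρ : ℚ
    ρ = 1ℚ - a

    0≤ρ : 0ℚ ≤ ρ
    0≤ρ = p≤q⇒0≤q-p a≤1

    remainder-step : ∀ T x → killedⁿ T h x ≡ survival l y T x + killedⁿ (suc T) h x
    remainder-step zero    x = h-equation x
    remainder-step (suc T) x = begin
        alive x * stepOp l (killedⁿ T h) x
      ≡⟨ cong (alive x *_) (stepOp-cong (remainder-step T) x) ⟩
        alive x * stepOp l (λ z → survival l y T z + killedⁿ (suc T) h z) x
      ≡⟨ cong (alive x *_) (stepOp-+ (survival l y T) (killedⁿ (suc T) h) x) ⟩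
        alive x * (stepOp l (survival l y T) x + stepOp l (killedⁿ (suc T) h) x)
      ≡⟨ *-distribˡ-+ (alive x) _ _ ⟩
        survival l y (suc T) x + killedⁿ (suc (suc T)) h x ∎
      where open ≡-Reasoning

    remainder : ∀ T x → partialSum l x y T + killedⁿ T h x ≡ h x
    remainder zero    x = +-identityˡ (h x)
    remainder (suc T) x = trans (+-assoc (partialSum l x y T) _ _)
      (trans (cong (_+_ (partialSum l x y T)) (sym (remainder-step T x))) (remainder T x))

    remainder-nonNeg : ∀ T x → 0ℚ ≤ killedⁿ T h x
    remainder-nonNeg zero    x = h-nonNeg x
    remainder-nonNeg (suc T) x = *-nonNeg (alive-nonNeg x) (stepOp-nonNeg (remainder-nonNeg T) x)

    -- killed h = h - alive ≤ (1 - a) h.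
    killed-contracts : ∀ x → killed h x ≤ ρ * h x
    killed-contracts x = begin
        killed h x
      ≡⟨ solve 2 (λ i k → k := (i :+ k) :- i) refl (alive x) (killed h x) ⟩
        (alive x + killed h x) - alive x
      ≡⟨ cong (_- alive x) (sym (h-equation x)) ⟩
        h x - alive x
      ≤⟨ +-monoʳ-≤ (h x) (neg-antimono-≤ (h-bounded x)) ⟩
        h x - a * h x
      ≡⟨ solve 2 (λ a h → h :- a :* h := (con 1ℚ :- a) :* h) refl a (h x) ⟩
        ρ * h x ∎
      where open ≤-Reasoning

    remainder-decay : ∀ T x → killedⁿ T h x ≤ ρ ^ T * h x
    remainder-decay zero    x = ≤-reflexive (sym (*-identityˡ (h x)))
    remainder-decay (suc T) x = begin
        alive x * stepOp l (killedⁿ T h) x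
      ≤⟨ *-monoˡ-≤ (alive-nonNeg x) (stepOp-mono (remainder-decay T) x) ⟩
        killed (λ z → ρ ^ T * h z) x
      ≡⟨ killed-* (ρ ^ T) h x ⟩
        ρ ^ T * killed h x
      ≤⟨ *-monoˡ-≤ (^-nonNeg 0≤ρ T) (killed-contracts x) ⟩
        ρ ^ T * (ρ * h x)
      ≡⟨ solve 3 (λ r ρ h → r :* (ρ :* h) := (ρ :* r) :* h) refl (ρ ^ T) ρ (h x) ⟩
        ρ ^ suc T * h x ∎
      where open ≤-Reasoning

    -- If N a² ε > 1 then ρᴺ h < ε, by Bernoulli and h ≤ 1/a.
    remainder-small : ∀ ε N → 1ℚ < ℕ→ℚ N * (a * a * ε) → ∀ x → ρ ^ N * h x < ε
    remainder-small ε N N-large x = *-cancelˡ-<-nonNeg c {{nonNegative 0≤c}} (begin-strict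
        c * (ρ ^ N * h x)
      ≡⟨ solve 4 (λ a ν r h → a :* (ν :* a) :* (r :* h) := (r :* (ν :* a)) :* (a :* h)) refl a ν (ρ ^ N) (h x) ⟩
        ρ ^ N * (ν * a) * (a * h x)
      ≤⟨ *-monoʳ-≤ (*-nonNeg 0≤a (h-nonNeg x)) decay ⟩
        1ℚ * (a * h x)
      ≡⟨ *-identityˡ (a * h x) ⟩
        a * h x
      ≤⟨ ≤-trans (h-bounded x) (alive-≤1 x) ⟩
        1ℚ
      <⟨ N-large ⟩
        ν * (a * a * ε)
      ≡⟨ solve 3 (λ ν a ε → ν :* (a :* a :* ε) := a :* (ν :* a) :* ε) refl ν a ε ⟩
        c * ε ∎)
      where
      open ≤-Reasoning
      ν = ℕ→ℚ N
      c = a * (ν * a)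
      0≤c : 0ℚ ≤ c
      0≤c = *-nonNeg 0≤a (*-nonNeg (ℕ→ℚ-nonNeg N) 0≤a)
      decay : ρ ^ N * (ν * a) ≤ 1ℚ
      decay = ≤-trans (*-monoˡ-≤ (^-nonNeg 0≤ρ N) (p≤q+p 0≤1)) (bernoulli 0≤a a≤1 N)

    hittingTime : ∀ x → HittingTime l x y (h x)
    hittingTime x ε 0<ε with archimedean (a * a * ε) 0<a²ε
      where
      0<a²ε : 0ℚ < a * a * ε
      0<a²ε = positive⁻¹ _ {{pos*pos⇒pos (a * a) {{pos*pos⇒pos a {{positive 0<a}} a {{positive 0<a}}}}
                                        ε {{positive 0<ε}}}}
    ... | N , N-large = N , close
      where
      close : ∀ T → N ℕ.≤ T → ∣ partialSum l x y T - h x ∣ < ε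
      close T N≤T = begin-strict
          ∣ partialSum l x y T - h x ∣
        ≡⟨ cong ∣_∣ (trans (cong (_-_ (partialSum l x y T)) (sym (remainder T x)))
                           (solve 2 (λ p k → p :- (p :+ k) := :- k) refl (partialSum l x y T) (killedⁿ T h x))) ⟩
          ∣ - killedⁿ T h x ∣
        ≡⟨ trans (∣-p∣≡∣p∣ (killedⁿ T h x)) (0≤p⇒∣p∣≡p (remainder-nonNeg T x)) ⟩
          killedⁿ T h x
        ≤⟨ remainder-decay T x ⟩
          ρ ^ T * h x
        ≤⟨ *-monoʳ-≤ (h-nonNeg x) (^-antitone 0≤ρ (p-q≤p 0≤a) N≤T) ⟩
          ρ ^ N * h x
        <⟨ remainder-small ε N N-large x ⟩
          ε ∎
        where open ≤-Reasoning

-- Integer potentials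

-- An integer potential for the target y is a bounded H : State → ℕ vanishing at y
-- such that Q = H/2 satisfies the hitting-time equation Q = 1 + P Q off y; after
-- clearing denominators that equation reads  l·H(x) = 4l + Σₖ H(move x k).
record IntegerPotential (l : ℕ) (y : State l) : Set where
  field
    H        : State l → ℕ
    bound    : ℕ
    target   : ∀ x → sameState x y ≡ true → H x ≡ 0
    harmonic : ∀ x → sameState x y ≡ false → l ℕ.* H x ≡ 4 ℕ.* l ℕ.+ sumℕ l (λ k → H (move x k))
    bounded  : ∀ x → H x ℕ.≤ bound

potential-hittingTime : ∀ {l′ y} (P : IntegerPotential (suc l′) y) (x : State (suc l′)) {q : ℚ} →
                        half * ℕ→ℚ (IntegerPotential.H P x) ≡ q → HittingTime (suc l′) x y q
potential-hittingTime {l′} {y} P x refl = hittingTime x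
  where
  open IntegerPotential P
  open ℚ-Solver
  l = suc l′
  open Absorption l y

  h : State l → ℚ
  h z = half * ℕ→ℚ (H z)

  a : ℚ
  a = + 1 / suc bound

  0<a : 0ℚ < a
  0<a = positive⁻¹ a {{normalize-pos 1 (suc bound)}}

  a·[bound+1]≡1 : a * ℕ→ℚ (suc bound) ≡ 1ℚ
  a·[bound+1]≡1 = 1/suc-inverse bound

  a≤1 : a ≤ 1ℚ
  a≤1 = begin
    a                       ≡⟨ *-identityʳ a ⟨
    a * 1ℚ                  ≤⟨ *-monoˡ-≤ (<⇒≤ 0<a) (ℕ→ℚ-mono-≤ (s≤s (z≤n {bound}))) ⟩
    a * ℕ→ℚ (suc bound)     ≡⟨ a·[bound+1]≡1 ⟩
    1ℚ                      ∎
    where open ≤-Reasoning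

  h-nonNeg : ∀ z → 0ℚ ≤ h z
  h-nonNeg z = *-nonNeg 0≤half (ℕ→ℚ-nonNeg (H z))

  equation-off-target : ∀ z → sameState z y ≡ false → h z ≡ 1ℚ + 1ℚ * stepOp l h z
  equation-off-target z off = begin
      half * η
    ≡⟨ solve 1 (λ η → con half :* η
                    := con 1ℚ :+ con half :* (con half :* η) :+ con (half * half) :* (con 1ℚ :* (η :- con (ℕ→ℚ 4))))
             refl η ⟩
      1ℚ + half * (half * η) + half * half * (1ℚ * (η - ℕ→ℚ 4))
    ≡⟨ cong (λ u → 1ℚ + half * (half * η) + half * half * (u * (η - ℕ→ℚ 4))) (sym (1/suc-inverse l′)) ⟩
      1ℚ + half * (half * η) + half * half * ((+ 1 / l) * λ′ * (η - ℕ→ℚ 4))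
    ≡⟨ solve 3 (λ η ι λ′ → con 1ℚ :+ con half :* (con half :* η) :+ con (half * half) :* (ι :* λ′ :* (η :- con (ℕ→ℚ 4)))
                        := con 1ℚ :+ con 1ℚ :* (con half :* (con half :* η) :+ (con half :* ι) :* (con half :* (λ′ :* η :- con (ℕ→ℚ 4) :* λ′))))
             refl η (+ 1 / l) λ′ ⟩
      1ℚ + 1ℚ * (half * (half * η) + edgeWeight * (half * (λ′ * η - ℕ→ℚ 4 * λ′)))
    ≡⟨ cong (λ s → 1ℚ + 1ℚ * (half * (half * η) + edgeWeight * (half * s))) (sym neighbour-sum) ⟩
      1ℚ + 1ℚ * (half * (half * η) + edgeWeight * (half * σ))
    ≡⟨ cong (λ s → 1ℚ + 1ℚ * (half * (half * η) + edgeWeight * s)) (sym sum-h) ⟩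
      1ℚ + 1ℚ * stepOp l h z ∎
    where
    open ≡-Reasoning
    η  = ℕ→ℚ (H z)
    λ′ = ℕ→ℚ l
    σ  = ℕ→ℚ (sumℕ l (λ k → H (move z k)))
    sum-h : sumFin l (λ k → h (move z k)) ≡ half * σ
    sum-h = trans (sumFin-* l half (λ k → ℕ→ℚ (H (move z k))))
                  (cong (half *_) (sumFin-ℕ→ℚ l (λ k → H (move z k))))
    harmonicℚ : λ′ * η ≡ ℕ→ℚ 4 * λ′ + σ
    harmonicℚ = begin
      λ′ * η                                        ≡⟨ ℕ→ℚ-* l (H z) ⟨
      ℕ→ℚ (l ℕ.* H z)                               ≡⟨ cong ℕ→ℚ (harmonic z off) ⟩
      ℕ→ℚ (4 ℕ.* l ℕ.+ sumℕ l (λ k → H (move z k))) ≡⟨ ℕ→ℚ-+ (4 ℕ.* l) _ ⟩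
      ℕ→ℚ (4 ℕ.* l) + σ                             ≡⟨ cong (_+ σ) (ℕ→ℚ-* 4 l) ⟩
      ℕ→ℚ 4 * λ′ + σ                                ∎
    neighbour-sum : σ ≡ λ′ * η - ℕ→ℚ 4 * λ′
    neighbour-sum = trans (solve 2 (λ s f → s := (f :+ s) :- f) refl σ (ℕ→ℚ 4 * λ′))
                          (cong (_- ℕ→ℚ 4 * λ′) (sym harmonicℚ))

  h-equation : ∀ z → h z ≡ alive z + killed h z
  h-equation z with sameState z y in e
  ... | true  = trans (cong (λ n → half * ℕ→ℚ n) (target z e))
                      (sym (trans (+-identityˡ (0ℚ * stepOp l h z)) (*-zeroˡ (stepOp l h z))))
  ... | false = equation-off-target z e

  h-bounded : ∀ z → a * h z ≤ alive z
  h-bounded z with sameState z y in e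
  ... | true  = ≤-reflexive (trans (cong (λ n → a * (half * ℕ→ℚ n)) (target z e))
                                   (trans (cong (a *_) (*-zeroʳ half)) (*-zeroʳ a)))
  ... | false = begin
      a * (half * ℕ→ℚ (H z))   ≤⟨ *-monoˡ-≤ (<⇒≤ 0<a) h≤bound+1 ⟩
      a * ℕ→ℚ (suc bound)      ≡⟨ a·[bound+1]≡1 ⟩
      1ℚ                       ∎
    where
    open ≤-Reasoning
    h≤bound+1 : half * ℕ→ℚ (H z) ≤ ℕ→ℚ (suc bound)
    h≤bound+1 = begin
      half * ℕ→ℚ (H z)                          ≡⟨ solve 1 (λ η → con half :* η := η :- con half :* η) refl (ℕ→ℚ (H z)) ⟩
      ℕ→ℚ (H z) - half * ℕ→ℚ (H z)              ≤⟨ p-q≤p (h-nonNeg z) ⟩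
      ℕ→ℚ (H z)                                 ≤⟨ ℕ→ℚ-mono-≤ (ℕP.m≤n⇒m≤1+n (bounded z)) ⟩
      ℕ→ℚ (suc bound)                           ∎

  open HittingEquation h a 0<a a≤1 h-equation h-nonNeg h-bounded

-- Sums of functions that are constant up to a few exceptions

update : ∀ {n} → (Fin n → ℕ) → Fin n → ℕ → Fin n → ℕ
update g a u k = if does (k ≟ a) then u else g k

update-other : ∀ {n} (g : Fin n → ℕ) a u k → k ≢ a → update g a u k ≡ g k
update-other g a u k k≢a with k ≟ a
... | yes k≡a = ⊥-elim (k≢a k≡a)
... | no  _   = refl

sumℕ-cong : ∀ n {f g : Fin n → ℕ} → (∀ k → f k ≡ g k) → sumℕ n f ≡ sumℕ n g
sumℕ-cong zero    f≡g = refl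
sumℕ-cong (suc n) f≡g = cong₂ ℕ._+_ (f≡g zero) (sumℕ-cong n (λ k → f≡g (suc k)))

sumℕ-const : ∀ n w → sumℕ n (λ _ → w) ≡ n ℕ.* w
sumℕ-const zero    w = refl
sumℕ-const (suc n) w = cong (w ℕ.+_) (sumℕ-const n w)

sumℕ-update : ∀ n (g : Fin n → ℕ) a u → sumℕ n (update g a u) ℕ.+ g a ≡ sumℕ n g ℕ.+ u
sumℕ-update (suc n) g zero u = begin
    (u ℕ.+ sumℕ n (λ k → update g zero u (suc k))) ℕ.+ g zero
  ≡⟨ cong (λ s → (u ℕ.+ s) ℕ.+ g zero) (sumℕ-cong n (λ k → update-other g zero u (suc k) (λ ()))) ⟩
    (u ℕ.+ rest) ℕ.+ g zero
  ≡⟨ solve 3 (λ u s g₀ → (u :+ s) :+ g₀ := (g₀ :+ s) :+ u) refl u rest (g zero) ⟩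
    (g zero ℕ.+ rest) ℕ.+ u ∎
  where
  open ≡-Reasoning
  open ℕ-Solver
  rest = sumℕ n (λ k → g (suc k))
sumℕ-update (suc n) g (suc a) u = begin
    (g zero ℕ.+ sumℕ n (λ k → update g (suc a) u (suc k))) ℕ.+ g (suc a)
  ≡⟨ ℕP.+-assoc (g zero) _ _ ⟩
    g zero ℕ.+ (sumℕ n (update (λ k → g (suc k)) a u) ℕ.+ g (suc a))
  ≡⟨ cong (g zero ℕ.+_) (sumℕ-update n (λ k → g (suc k)) a u) ⟩
    g zero ℕ.+ (sumℕ n (λ k → g (suc k)) ℕ.+ u)
  ≡⟨ ℕP.+-assoc (g zero) _ _ ⟨
    (g zero ℕ.+ sumℕ n (λ k → g (suc k))) ℕ.+ u ∎
  where open ≡-Reasoning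

sumℕ-two-exceptions : ∀ n w a u b v → b ≢ a →
  sumℕ n (update (update (λ _ → w) a u) b v) ℕ.+ (w ℕ.+ w) ≡ n ℕ.* w ℕ.+ u ℕ.+ v
sumℕ-two-exceptions n w a u b v b≢a = begin
    sumℕ n g₂ ℕ.+ (w ℕ.+ w)
  ≡⟨ ℕP.+-assoc (sumℕ n g₂) w w ⟨
    (sumℕ n g₂ ℕ.+ w) ℕ.+ w
  ≡⟨ cong (λ z → (sumℕ n g₂ ℕ.+ z) ℕ.+ w) (update-other (λ _ → w) a u b b≢a) ⟨
    (sumℕ n g₂ ℕ.+ g₁ b) ℕ.+ w
  ≡⟨ cong (ℕ._+ w) (sumℕ-update n g₁ b v) ⟩
    (sumℕ n g₁ ℕ.+ v) ℕ.+ w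
  ≡⟨ xy∙z≈xz∙y (sumℕ n g₁) v w ⟩
    (sumℕ n g₁ ℕ.+ w) ℕ.+ v
  ≡⟨ cong (ℕ._+ v) (trans (sumℕ-update n (λ _ → w) a u) (cong (ℕ._+ u) (sumℕ-const n w))) ⟩
    n ℕ.* w ℕ.+ u ℕ.+ v ∎
  where
  open ≡-Reasoning
  g₁ = update (λ _ → w) a u
  g₂ = update g₁ b v

sumℕ-three-exceptions : ∀ n w a u b v c z → b ≢ a → c ≢ a → c ≢ b →
  sumℕ n (update (update (update (λ _ → w) a u) b v) c z) ℕ.+ (w ℕ.+ w ℕ.+ w) ≡ n ℕ.* w ℕ.+ u ℕ.+ v ℕ.+ z
sumℕ-three-exceptions n w a u b v c z b≢a c≢a c≢b = begin
    sumℕ n g₃ ℕ.+ ((w ℕ.+ w) ℕ.+ w)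
  ≡⟨ cong (sumℕ n g₃ ℕ.+_) (ℕP.+-comm (w ℕ.+ w) w) ⟩
    sumℕ n g₃ ℕ.+ (w ℕ.+ (w ℕ.+ w))
  ≡⟨ ℕP.+-assoc (sumℕ n g₃) w (w ℕ.+ w) ⟨
    (sumℕ n g₃ ℕ.+ w) ℕ.+ (w ℕ.+ w)
  ≡⟨ cong (λ t → (sumℕ n g₃ ℕ.+ t) ℕ.+ (w ℕ.+ w)) g₂c≡w ⟨
    (sumℕ n g₃ ℕ.+ g₂ c) ℕ.+ (w ℕ.+ w)
  ≡⟨ cong (ℕ._+ (w ℕ.+ w)) (sumℕ-update n g₂ c z) ⟩
    (sumℕ n g₂ ℕ.+ z) ℕ.+ (w ℕ.+ w)
  ≡⟨ xy∙z≈xz∙y (sumℕ n g₂) z (w ℕ.+ w) ⟩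
    (sumℕ n g₂ ℕ.+ (w ℕ.+ w)) ℕ.+ z
  ≡⟨ cong (ℕ._+ z) (sumℕ-two-exceptions n w a u b v b≢a) ⟩
    n ℕ.* w ℕ.+ u ℕ.+ v ℕ.+ z ∎
  where
  open ≡-Reasoning
  g₁ = update (λ _ → w) a u
  g₂ = update g₁ b v
  g₃ = update g₂ c z
  g₂c≡w : g₂ c ≡ w
  g₂c≡w = trans (update-other g₁ b v c c≢b) (update-other (λ _ → w) a u c c≢a)

≤-by-offset : ∀ {m n} d → m ℕ.+ d ≡ n → m ℕ.≤ n
≤-by-offset {m} d refl = ℕP.m≤m+n m d

-- To verify an equation  t = d + Σ f  it suffices to know f pointwise as some g whose
-- sum is known up to an offset X, and to check the resulting closed identity.
equation-from-sum : ∀ n d X {t Y} {f g : Fin n → ℕ} → (∀ k → f k ≡ g k) →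
                    sumℕ n g ℕ.+ X ≡ Y → t ℕ.+ X ≡ d ℕ.+ Y → t ≡ d ℕ.+ sumℕ n f
equation-from-sum n d X {t} {Y} {f} {g} f≡g sum-g identity = ℕP.+-cancelʳ-≡ X t (d ℕ.+ sumℕ n f) (begin
    t ℕ.+ X                      ≡⟨ identity ⟩
    d ℕ.+ Y                      ≡⟨ cong (d ℕ.+_) (trans (cong (ℕ._+ X) (sumℕ-cong n f≡g)) sum-g) ⟨
    d ℕ.+ (sumℕ n f ℕ.+ X)       ≡⟨ ℕP.+-assoc d (sumℕ n f) X ⟨
    d ℕ.+ sumℕ n f ℕ.+ X         ∎)
  where open ≡-Reasoning

-- The moves of the exclusion process on the star graph

move-centre-self : ∀ {l} (i : Fin l) → move (cl i) i ≡ cl i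
move-centre-self i with i ≟ i
... | yes _   = refl
... | no  i≢i = ⊥-elim (i≢i refl)

move-centre-other : ∀ {l} (i k : Fin l) → i ≢ k → move (cl i) k ≡ leafPair i k
move-centre-other i k i≢k with i ≟ k
... | yes i≡k = ⊥-elim (i≢k i≡k)
... | no  _   = refl

move-leaf-first : ∀ {l} (i j : Fin l) i<j → move (ll i j i<j) i ≡ cl j
move-leaf-first i j i<j with i ≟ i
... | yes _   = refl
... | no  i≢i = ⊥-elim (i≢i refl)

move-leaf-second : ∀ {l} (i j : Fin l) i<j → move (ll i j i<j) j ≡ cl i
move-leaf-second i j i<j with i ≟ j | j ≟ j
... | yes i≡j | _       = ⊥-elim (<⇒≢ i<j i≡j)
... | no  _   | yes _   = refl
... | no  _   | no  j≢j = ⊥-elim (j≢j refl)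

move-leaf-other : ∀ {l} (i j : Fin l) i<j k → i ≢ k → j ≢ k → move (ll i j i<j) k ≡ ll i j i<j
move-leaf-other i j i<j k i≢k j≢k with i ≟ k | j ≟ k
... | yes i≡k | _       = ⊥-elim (i≢k i≡k)
... | no  _   | yes j≡k = ⊥-elim (j≢k j≡k)
... | no  _   | no  _   = refl

leafPair-cases : ∀ {l} (i j : Fin l) → i ≢ j →
  (∃ λ i<j → leafPair i j ≡ ll i j i<j) ⊎ (∃ λ j<i → leafPair i j ≡ ll j i j<i)
leafPair-cases i j i≢j with <-cmp i j
... | tri< i<j _ _ = inj₁ (i<j , refl)
... | tri> _ _ j<i = inj₂ (j<i , refl)
... | tri≈ _ i≡j _ = ⊥-elim (i≢j i≡j)

cubicExpr : ℕ → ℕ → ℕ → ℕ-Solver.Polynomial 1 → ℕ-Solver.Polynomial 1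
cubicExpr a b c L = con a :* L :* L :* L :+ con b :* L :* L :+ con c :* L
  where open ℕ-Solver

-- Target "1": one particle at the centre, the other at leaf 1

-- For l = m + 3 the doubled expected hitting times of "1" are
--   H("1") = 0,  H("i") = 4l² + 4l,  H({1,j}) = 2l² + 4l,  H({i,j}) = 4l² + 6l   (i, j ≠ 1).
module TargetCentre (m : ℕ) where
  open ℕ-Solver

  l : ℕ
  l = 3 ℕ.+ m

  centre pairWith1 pair : ℕ
  centre    = cubic 0 4 4 l
  pairWith1 = cubic 0 2 4 l
  pair      = cubic 0 4 6 l

  H : State l → ℕ
  H (cl zero)          = 0
  H (cl (suc _))       = centre
  H (ll zero _ _)      = pairWith1
  H (ll (suc _) _ _)   = pair

  centre-identity : l ℕ.* centre ℕ.+ (pair ℕ.+ pair) ≡ 4 ℕ.* l ℕ.+ (l ℕ.* pair ℕ.+ centre ℕ.+ pairWith1)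
  centre-identity = solve 1 (λ m → let L = con 3 :+ m ; A = cubicExpr 0 4 4 L
                                       B = cubicExpr 0 2 4 L ; C = cubicExpr 0 4 6 L
                                   in L :* A :+ (C :+ C) := con 4 :* L :+ (L :* C :+ A :+ B)) refl m

  pairWith1-identity : l ℕ.* pairWith1 ℕ.+ (pairWith1 ℕ.+ pairWith1) ≡ 4 ℕ.* l ℕ.+ (l ℕ.* pairWith1 ℕ.+ centre ℕ.+ 0)
  pairWith1-identity = solve 1 (λ m → let L = con 3 :+ m ; A = cubicExpr 0 4 4 L
                                          B = cubicExpr 0 2 4 L
                                      in L :* B :+ (B :+ B) := con 4 :* L :+ (L :* B :+ A :+ con 0)) refl m

  pair-identity : l ℕ.* pair ℕ.+ (pair ℕ.+ pair) ≡ 4 ℕ.* l ℕ.+ (l ℕ.* pair ℕ.+ centre ℕ.+ centre)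
  pair-identity = solve 1 (λ m → let L = con 3 :+ m ; A = cubicExpr 0 4 4 L
                                     C = cubicExpr 0 4 6 L
                                 in L :* C :+ (C :+ C) := con 4 :* L :+ (L :* C :+ A :+ A)) refl m

  pair-of-others : ∀ (i k : Fin (2 ℕ.+ m)) → i ≢ k → H (leafPair (suc i) (suc k)) ≡ pair
  pair-of-others i k i≢k with leafPair-cases (suc i) (suc k) (λ e → i≢k (suc-injective e))
  ... | inj₁ (_ , e) = cong H e
  ... | inj₂ (_ , e) = cong H e

  moves-centre : ∀ i k → H (move (cl (suc i)) k) ≡ update (update (λ _ → pair) (suc i) centre) zero pairWith1 k
  moves-centre i zero    = refl
  moves-centre i (suc k) with k ≟ i
  ... | yes refl = cong H (move-centre-self (suc i))
  ... | no  k≢i  = trans (cong H (move-centre-other (suc i) (suc k) (λ e → k≢i (sym (suc-injective e)))))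
                         (pair-of-others i k (λ e → k≢i (sym e)))

  moves-pairWith1 : ∀ j j>0 k → H (move (ll zero (suc j) j>0) k) ≡ update (update (λ _ → pairWith1) zero centre) (suc j) 0 k
  moves-pairWith1 j j>0 zero    = refl
  moves-pairWith1 j j>0 (suc k) with k ≟ j
  ... | yes refl = cong H (move-leaf-second zero (suc j) j>0)
  ... | no  k≢j  = cong H (move-leaf-other zero (suc j) j>0 (suc k) (λ ()) (λ e → k≢j (sym (suc-injective e))))

  moves-pair : ∀ i j i<j k → H (move (ll (suc i) (suc j) i<j) k) ≡ update (update (λ _ → pair) (suc i) centre) (suc j) centre k
  moves-pair i j i<j k with k ≟ suc i | k ≟ suc j
  ... | yes refl | yes k≡j = ⊥-elim (<⇒≢ i<j k≡j)
  ... | yes refl | no  _   = cong H (move-leaf-first (suc i) (suc j) i<j)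
  ... | no  _    | yes refl = cong H (move-leaf-second (suc i) (suc j) i<j)
  ... | no  k≢i  | no  k≢j  = cong H (move-leaf-other (suc i) (suc j) i<j k (λ e → k≢i (sym e)) (λ e → k≢j (sym e)))

  harmonic : ∀ x → sameState x (cl zero) ≡ false → l ℕ.* H x ≡ 4 ℕ.* l ℕ.+ sumℕ l (λ k → H (move x k))
  harmonic (cl zero)             ()
  harmonic (cl (suc i))          _ = equation-from-sum l (4 ℕ.* l) (pair ℕ.+ pair) (moves-centre i)
    (sumℕ-two-exceptions l pair (suc i) centre zero pairWith1 (λ ())) centre-identity
  harmonic (ll zero (suc j) j>0) _ = equation-from-sum l (4 ℕ.* l) (pairWith1 ℕ.+ pairWith1) (moves-pairWith1 j j>0)
    (sumℕ-two-exceptions l pairWith1 zero centre (suc j) 0 (λ ())) pairWith1-identity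
  harmonic (ll (suc i) (suc j) i<j) _ = equation-from-sum l (4 ℕ.* l) (pair ℕ.+ pair) (moves-pair i j i<j)
    (sumℕ-two-exceptions l pair (suc i) centre (suc j) centre (λ e → <⇒≢ i<j (sym e))) pair-identity

  target : ∀ x → sameState x (cl zero) ≡ true → H x ≡ 0
  target (cl zero)      _ = refl
  target (cl (suc _))   ()
  target (ll _ _ _)     ()

  bounded : ∀ x → H x ℕ.≤ pair
  bounded (cl zero)        = z≤n
  bounded (cl (suc _))     = ≤-by-offset (2 ℕ.* l) (solve 1 (λ m → let L = con 3 :+ m in
                               (cubicExpr 0 4 4 L) :+ con 2 :* L := cubicExpr 0 4 6 L) refl m)
  bounded (ll zero _ _)    = ≤-by-offset (2 ℕ.* l ℕ.* l ℕ.+ 2 ℕ.* l) (solve 1 (λ m → let L = con 3 :+ m in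
                               (cubicExpr 0 2 4 L) :+ (con 2 :* L :* L :+ con 2 :* L) := cubicExpr 0 4 6 L) refl m)
  bounded (ll (suc _) _ _) = ℕP.≤-refl

  potential : IntegerPotential l (cl zero)
  potential = record { H = H ; bound = pair ; target = target ; harmonic = harmonic ; bounded = bounded }

-- Target {1,2}: the particles at leaves 1 and 2

-- For l = m + 3 the doubled expected hitting times of {1,2} are, for i, j ∉ {1,2},
--   H({1,2}) = 0,                 H("1") = H("2") = l(l+2)(l-1) = l³ + l² - 2l,
--   H("i") = l³ + 3l²,            H({1,j}) = H({2,j}) = l³ + 2l² + l,
--   H({i,j}) = l³ + 3l² + 2l.
module TargetPair (m : ℕ) where
  open ℕ-Solver

  l : ℕ
  l = 3 ℕ.+ m

  centreIn centreOut pairOverlap pairDisjoint : ℕ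
  centreIn     = l ℕ.* (5 ℕ.+ m) ℕ.* (2 ℕ.+ m)
  centreOut    = cubic 1 3 0 l
  pairOverlap  = cubic 1 2 1 l
  pairDisjoint = cubic 1 3 2 l

  centreIn-cubic : centreIn ℕ.+ 2 ℕ.* l ≡ cubic 1 1 0 l
  centreIn-cubic = solve 1 (λ m → let L = con 3 :+ m in
    L :* (con 5 :+ m) :* (con 2 :+ m) :+ con 2 :* L := cubicExpr 1 1 0 L) refl m

  H : State l → ℕ
  H (cl zero)                            = centreIn
  H (cl (suc zero))                      = centreIn
  H (cl (suc (suc _)))                   = centreOut
  H (ll zero (suc zero) _)               = 0
  H (ll zero (suc (suc _)) _)            = pairOverlap
  H (ll (suc zero) (suc (suc _)) _)      = pairOverlap
  H (ll (suc (suc _)) _ _)               = pairDisjoint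
  H (ll (suc zero) (suc zero) (s≤s ()))
  H (ll zero zero ())
  H (ll (suc zero) zero ())

  centreIn-identity : l ℕ.* centreIn ℕ.+ (pairOverlap ℕ.+ pairOverlap) ≡ 4 ℕ.* l ℕ.+ (l ℕ.* pairOverlap ℕ.+ centreIn ℕ.+ 0)
  centreIn-identity = solve 1 (λ m → let L = con 3 :+ m ; P = L :* (con 5 :+ m) :* (con 2 :+ m)
                                         R = cubicExpr 1 2 1 L
                                     in L :* P :+ (R :+ R) := con 4 :* L :+ (L :* R :+ P :+ con 0)) refl m

  centreOut-identity : l ℕ.* centreOut ℕ.+ (pairDisjoint ℕ.+ pairDisjoint ℕ.+ pairDisjoint)
                     ≡ 4 ℕ.* l ℕ.+ (l ℕ.* pairDisjoint ℕ.+ centreOut ℕ.+ pairOverlap ℕ.+ pairOverlap)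
  centreOut-identity = solve 1 (λ m → let L = con 3 :+ m ; Q = cubicExpr 1 3 0 L
                                          R = cubicExpr 1 2 1 L
                                          S = cubicExpr 1 3 2 L
                                      in L :* Q :+ (S :+ S :+ S) := con 4 :* L :+ (L :* S :+ Q :+ R :+ R)) refl m

  pairOverlap-identity : l ℕ.* pairOverlap ℕ.+ (pairOverlap ℕ.+ pairOverlap)
                       ≡ 4 ℕ.* l ℕ.+ (l ℕ.* pairOverlap ℕ.+ centreOut ℕ.+ centreIn)
  pairOverlap-identity = solve 1 (λ m → let L = con 3 :+ m ; P = L :* (con 5 :+ m) :* (con 2 :+ m)
                                            Q = cubicExpr 1 3 0 L
                                            R = cubicExpr 1 2 1 L
                                        in L :* R :+ (R :+ R) := con 4 :* L :+ (L :* R :+ Q :+ P)) refl m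

  pairDisjoint-identity : l ℕ.* pairDisjoint ℕ.+ (pairDisjoint ℕ.+ pairDisjoint)
                        ≡ 4 ℕ.* l ℕ.+ (l ℕ.* pairDisjoint ℕ.+ centreOut ℕ.+ centreOut)
  pairDisjoint-identity = solve 1 (λ m → let L = con 3 :+ m ; Q = cubicExpr 1 3 0 L
                                             S = cubicExpr 1 3 2 L
                                         in L :* S :+ (S :+ S) := con 4 :* L :+ (L :* S :+ Q :+ Q)) refl m

  disjoint-of-others : ∀ (i k : Fin (1 ℕ.+ m)) → i ≢ k → H (leafPair (suc (suc i)) (suc (suc k))) ≡ pairDisjoint
  disjoint-of-others i k i≢k with leafPair-cases (suc (suc i)) (suc (suc k)) (λ e → i≢k (suc-injective (suc-injective e)))
  ... | inj₁ (_ , e) = cong H e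
  ... | inj₂ (_ , e) = cong H e

  moves-centre₁ : ∀ k → H (move (cl zero) k) ≡ update (update (λ _ → pairOverlap) zero centreIn) (suc zero) 0 k
  moves-centre₁ zero          = refl
  moves-centre₁ (suc zero)    = refl
  moves-centre₁ (suc (suc k)) = refl

  moves-centre₂ : ∀ k → H (move (cl (suc zero)) k) ≡ update (update (λ _ → pairOverlap) (suc zero) centreIn) zero 0 k
  moves-centre₂ zero          = refl
  moves-centre₂ (suc zero)    = refl
  moves-centre₂ (suc (suc k)) = refl

  moves-centreOut : ∀ i k → H (move (cl (suc (suc i))) k)
                  ≡ update (update (update (λ _ → pairDisjoint) (suc (suc i)) centreOut) zero pairOverlap) (suc zero) pairOverlap k
  moves-centreOut i zero          = refl
  moves-centreOut i (suc zero)    = refl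
  moves-centreOut i (suc (suc k)) with k ≟ i
  ... | yes refl = cong H (move-centre-self (suc (suc i)))
  ... | no  k≢i  = trans (cong H (move-centre-other (suc (suc i)) (suc (suc k))
                                    (λ e → k≢i (sym (suc-injective (suc-injective e))))))
                         (disjoint-of-others i k (λ e → k≢i (sym e)))

  moves-pairWith1 : ∀ j j>0 k → H (move (ll zero (suc (suc j)) j>0) k)
                  ≡ update (update (λ _ → pairOverlap) zero centreOut) (suc (suc j)) centreIn k
  moves-pairWith1 j j>0 zero          = refl
  moves-pairWith1 j j>0 (suc zero)    = refl
  moves-pairWith1 j j>0 (suc (suc k)) with k ≟ j
  ... | yes refl = cong H (move-leaf-second zero (suc (suc j)) j>0)
  ... | no  k≢j  = cong H (move-leaf-other zero (suc (suc j)) j>0 (suc (suc k)) (λ ())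
                                             (λ e → k≢j (sym (suc-injective (suc-injective e)))))

  moves-pairWith2 : ∀ j j>1 k → H (move (ll (suc zero) (suc (suc j)) j>1) k)
                  ≡ update (update (λ _ → pairOverlap) (suc zero) centreOut) (suc (suc j)) centreIn k
  moves-pairWith2 j j>1 zero          = refl
  moves-pairWith2 j j>1 (suc zero)    = refl
  moves-pairWith2 j j>1 (suc (suc k)) with k ≟ j
  ... | yes refl = cong H (move-leaf-second (suc zero) (suc (suc j)) j>1)
  ... | no  k≢j  = cong H (move-leaf-other (suc zero) (suc (suc j)) j>1 (suc (suc k)) (λ ())
                                             (λ e → k≢j (sym (suc-injective (suc-injective e)))))

  moves-pairDisjoint : ∀ i j i<j k → H (move (ll (suc (suc i)) (suc (suc j)) i<j) k)
                     ≡ update (update (λ _ → pairDisjoint) (suc (suc i)) centreOut) (suc (suc j)) centreOut k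
  moves-pairDisjoint i j i<j k with k ≟ suc (suc i) | k ≟ suc (suc j)
  ... | yes refl | yes k≡j  = ⊥-elim (<⇒≢ i<j k≡j)
  ... | yes refl | no  _    = cong H (move-leaf-first (suc (suc i)) (suc (suc j)) i<j)
  ... | no  _    | yes refl = cong H (move-leaf-second (suc (suc i)) (suc (suc j)) i<j)
  ... | no  k≢i  | no  k≢j  = cong H (move-leaf-other (suc (suc i)) (suc (suc j)) i<j k (λ e → k≢i (sym e)) (λ e → k≢j (sym e)))

  harmonic : ∀ x → sameState x (ll zero (suc zero) (s≤s z≤n)) ≡ false →
             l ℕ.* H x ≡ 4 ℕ.* l ℕ.+ sumℕ l (λ k → H (move x k))
  harmonic (cl zero)          _ = equation-from-sum l (4 ℕ.* l) (pairOverlap ℕ.+ pairOverlap) moves-centre₁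
    (sumℕ-two-exceptions l pairOverlap zero centreIn (suc zero) 0 (λ ())) centreIn-identity
  harmonic (cl (suc zero))    _ = equation-from-sum l (4 ℕ.* l) (pairOverlap ℕ.+ pairOverlap) moves-centre₂
    (sumℕ-two-exceptions l pairOverlap (suc zero) centreIn zero 0 (λ ())) centreIn-identity
  harmonic (cl (suc (suc i))) _ =
    equation-from-sum l (4 ℕ.* l) (pairDisjoint ℕ.+ pairDisjoint ℕ.+ pairDisjoint) (moves-centreOut i)
      (sumℕ-three-exceptions l pairDisjoint (suc (suc i)) centreOut zero pairOverlap (suc zero) pairOverlap
                             (λ ()) (λ ()) (λ ()))
      centreOut-identity
  harmonic (ll zero (suc zero) _)          ()
  harmonic (ll zero (suc (suc j)) j>0)     _ = equation-from-sum l (4 ℕ.* l) (pairOverlap ℕ.+ pairOverlap)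
    (moves-pairWith1 j j>0) (sumℕ-two-exceptions l pairOverlap zero centreOut (suc (suc j)) centreIn (λ ()))
    pairOverlap-identity
  harmonic (ll (suc zero) (suc (suc j)) j>1) _ = equation-from-sum l (4 ℕ.* l) (pairOverlap ℕ.+ pairOverlap)
    (moves-pairWith2 j j>1) (sumℕ-two-exceptions l pairOverlap (suc zero) centreOut (suc (suc j)) centreIn (λ ()))
    pairOverlap-identity
  harmonic (ll (suc (suc i)) (suc (suc j)) i<j) _ = equation-from-sum l (4 ℕ.* l) (pairDisjoint ℕ.+ pairDisjoint)
    (moves-pairDisjoint i j i<j)
    (sumℕ-two-exceptions l pairDisjoint (suc (suc i)) centreOut (suc (suc j)) centreOut (λ e → <⇒≢ i<j (sym e)))
    pairDisjoint-identity
  harmonic (ll (suc zero) (suc zero) (s≤s ())) _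
  harmonic (ll zero zero ()) _
  harmonic (ll (suc zero) zero ()) _
  harmonic (ll (suc (suc _)) zero ()) _
  harmonic (ll (suc (suc _)) (suc zero) (s≤s ())) _

  target : ∀ x → sameState x (ll zero (suc zero) (s≤s z≤n)) ≡ true → H x ≡ 0
  target (ll zero (suc zero) _)     _ = refl
  target (cl _)                     ()
  target (ll zero zero _)           ()
  target (ll zero (suc (suc _)) _)  ()
  target (ll (suc _) _ _)           ()

  bounded : ∀ x → H x ℕ.≤ pairDisjoint
  bounded (cl zero)                         = centreIn≤pairDisjoint
    where
    centreIn≤pairDisjoint : centreIn ℕ.≤ pairDisjoint
    centreIn≤pairDisjoint = ≤-by-offset (2 ℕ.* l ℕ.* l ℕ.+ 4 ℕ.* l)
      (solve 1 (λ m → let L = con 3 :+ m in L :* (con 5 :+ m) :* (con 2 :+ m) :+ (cubicExpr 0 2 4 L)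
                                         := cubicExpr 1 3 2 L) refl m)
  bounded (cl (suc zero))                   = bounded (cl zero)
  bounded (cl (suc (suc _)))                = ≤-by-offset (2 ℕ.* l)
    (solve 1 (λ m → let L = con 3 :+ m in (cubicExpr 1 3 0 L) :+ con 2 :* L
                                       := cubicExpr 1 3 2 L) refl m)
  bounded (ll zero (suc zero) _)            = z≤n
  bounded (ll zero (suc (suc _)) _)         = pairOverlap≤pairDisjoint
    where
    pairOverlap≤pairDisjoint : pairOverlap ℕ.≤ pairDisjoint
    pairOverlap≤pairDisjoint = ≤-by-offset (l ℕ.* l ℕ.+ l)
      (solve 1 (λ m → let L = con 3 :+ m in (cubicExpr 1 2 1 L) :+ (L :* L :+ L)
                                         := cubicExpr 1 3 2 L) refl m)
  bounded (ll (suc zero) (suc (suc j)) _)   = bounded (ll zero (suc (suc j)) (s≤s z≤n))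
  bounded (ll (suc (suc _)) _ _)            = ℕP.≤-refl
  bounded (ll (suc zero) (suc zero) (s≤s ()))
  bounded (ll zero zero ())

  potential : IntegerPotential l (ll zero (suc zero) (s≤s z≤n))
  potential = record { H = H ; bound = pairDisjoint ; target = target ; harmonic = harmonic ; bounded = bounded }

cubicExprℚ : ℕ → ℕ → ℕ → ℚ-Solver.Polynomial 1 → ℚ-Solver.Polynomial 1
cubicExprℚ a b c L = con (ℕ→ℚ a) :* L :* L :* L :+ con (ℕ→ℚ b) :* L :* L :+ con (ℕ→ℚ c) :* L
  where open ℚ-Solver

module Values (m : ℕ) where
  open ℚ-Solver
  open TargetCentre m using (l; centre; pairWith1; pair)
  open TargetPair m using (centreIn; centreIn-cubic; centreOut; pairOverlap; pairDisjoint)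

  L : ℚ
  L = ℕ→ℚ l

  centre/2 : half * ℕ→ℚ centre ≡ ℕ→ℚ 2 * L * L + ℕ→ℚ 2 * L
  centre/2 = trans (cong (half *_) (ℕ→ℚ-cubic 0 4 4 l))
    (solve 1 (λ x → con half :* cubicExprℚ 0 4 4 x := con (ℕ→ℚ 2) :* x :* x :+ con (ℕ→ℚ 2) :* x) refl L)

  pairWith1/2 : half * ℕ→ℚ pairWith1 ≡ L * L + ℕ→ℚ 2 * L
  pairWith1/2 = trans (cong (half *_) (ℕ→ℚ-cubic 0 2 4 l))
    (solve 1 (λ x → con half :* cubicExprℚ 0 2 4 x := x :* x :+ con (ℕ→ℚ 2) :* x) refl L)

  pair/2 : half * ℕ→ℚ pair ≡ ℕ→ℚ 2 * L * L + ℕ→ℚ 3 * L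
  pair/2 = trans (cong (half *_) (ℕ→ℚ-cubic 0 4 6 l))
    (solve 1 (λ x → con half :* cubicExprℚ 0 4 6 x := con (ℕ→ℚ 2) :* x :* x :+ con (ℕ→ℚ 3) :* x) refl L)

  centreIn/2 : half * ℕ→ℚ centreIn ≡ half * (L * L * L + L * L - ℕ→ℚ 2 * L)
  centreIn/2 = begin
      half * ℕ→ℚ centreIn
    ≡⟨ solve 2 (λ n t → con half :* n := con half :* ((n :+ t) :- t)) refl (ℕ→ℚ centreIn) (ℕ→ℚ 2 * L) ⟩
      half * ((ℕ→ℚ centreIn + ℕ→ℚ 2 * L) - ℕ→ℚ 2 * L)
    ≡⟨ cong (λ s → half * (s - ℕ→ℚ 2 * L)) shifted ⟩
      half * ((ℕ→ℚ 1 * L * L * L + ℕ→ℚ 1 * L * L + ℕ→ℚ 0 * L) - ℕ→ℚ 2 * L)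
    ≡⟨ solve 1 (λ x → con half :* (cubicExprℚ 1 1 0 x :- con (ℕ→ℚ 2) :* x)
                    := con half :* (x :* x :* x :+ x :* x :- con (ℕ→ℚ 2) :* x)) refl L ⟩
      half * (L * L * L + L * L - ℕ→ℚ 2 * L) ∎
    where
    open ≡-Reasoning
    shifted : ℕ→ℚ centreIn + ℕ→ℚ 2 * L ≡ ℕ→ℚ 1 * L * L * L + ℕ→ℚ 1 * L * L + ℕ→ℚ 0 * L
    shifted = begin
      ℕ→ℚ centreIn + ℕ→ℚ 2 * L      ≡⟨ cong (_+_ (ℕ→ℚ centreIn)) (ℕ→ℚ-* 2 l) ⟨
      ℕ→ℚ centreIn + ℕ→ℚ (2 ℕ.* l)  ≡⟨ ℕ→ℚ-+ centreIn (2 ℕ.* l) ⟨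
      ℕ→ℚ (centreIn ℕ.+ 2 ℕ.* l)     ≡⟨ cong ℕ→ℚ centreIn-cubic ⟩
      ℕ→ℚ (cubic 1 1 0 l)            ≡⟨ ℕ→ℚ-cubic 1 1 0 l ⟩
      ℕ→ℚ 1 * L * L * L + ℕ→ℚ 1 * L * L + ℕ→ℚ 0 * L ∎

  centreOut/2 : half * ℕ→ℚ centreOut ≡ half * (L * L * L + ℕ→ℚ 3 * L * L)
  centreOut/2 = trans (cong (half *_) (ℕ→ℚ-cubic 1 3 0 l))
    (solve 1 (λ x → con half :* cubicExprℚ 1 3 0 x := con half :* (x :* x :* x :+ con (ℕ→ℚ 3) :* x :* x)) refl L)

  pairOverlap/2 : half * ℕ→ℚ pairOverlap ≡ half * (L * L * L + ℕ→ℚ 2 * L * L + L)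
  pairOverlap/2 = trans (cong (half *_) (ℕ→ℚ-cubic 1 2 1 l))
    (solve 1 (λ x → con half :* cubicExprℚ 1 2 1 x := con half :* (x :* x :* x :+ con (ℕ→ℚ 2) :* x :* x :+ x)) refl L)

  pairDisjoint/2 : half * ℕ→ℚ pairDisjoint ≡ half * (L * L * L + ℕ→ℚ 3 * L * L + ℕ→ℚ 2 * L)
  pairDisjoint/2 = trans (cong (half *_) (ℕ→ℚ-cubic 1 3 2 l))
    (solve 1 (λ x → con half :* cubicExprℚ 1 3 2 x
                  := con half :* (x :* x :* x :+ con (ℕ→ℚ 3) :* x :* x :+ con (ℕ→ℚ 2) :* x)) refl L)

-- The theorem: each identity is half the corresponding potential value; the state {3,4} needs
-- l ≥ 4, i.e. m = n + 1.
mainTheorem10 : ((m : ℕ) →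
    let l = 3 ℕ.+ m
        L = ℕ→ℚ l
    in HittingTime l (ll zero (suc zero) (s≤s z≤n)) (cl zero) (L * L + ℕ→ℚ 2 * L)
     × HittingTime l (ll (suc zero) (suc (suc zero)) (s≤s (s≤s z≤n))) (cl zero) (ℕ→ℚ 2 * L * L + ℕ→ℚ 3 * L)
     × HittingTime l (cl (suc zero)) (cl zero) (ℕ→ℚ 2 * L * L + ℕ→ℚ 2 * L)
     × HittingTime l (cl zero) (ll zero (suc zero) (s≤s z≤n)) (half * (L * L * L + L * L - ℕ→ℚ 2 * L))
     × HittingTime l (cl (suc (suc zero))) (ll zero (suc zero) (s≤s z≤n)) (half * (L * L * L + ℕ→ℚ 3 * L * L))
     × HittingTime l (ll zero (suc (suc zero)) (s≤s z≤n)) (ll zero (suc zero) (s≤s z≤n)) (half * (L * L * L + ℕ→ℚ 2 * L * L + L)))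
  × ((n : ℕ) →
    let l = 4 ℕ.+ n
        L = ℕ→ℚ l
    in HittingTime l (ll (suc (suc zero)) (suc (suc (suc zero))) (s≤s (s≤s (s≤s z≤n)))) (ll zero (suc zero) (s≤s z≤n))
         (half * (L * L * L + ℕ→ℚ 3 * L * L + ℕ→ℚ 2 * L)))
mainTheorem10 =
    (λ m → let open Values m
               toCentre = potential-hittingTime (TargetCentre.potential m)
               toPair   = potential-hittingTime (TargetPair.potential m)
           in toCentre (ll zero (suc zero) (s≤s z≤n))               pairWith1/2
            , toCentre (ll (suc zero) (suc (suc zero)) (s≤s (s≤s z≤n))) pair/2
            , toCentre (cl (suc zero))                               centre/2
            , toPair   (cl zero)                                     centreIn/2
            , toPair   (cl (suc (suc zero)))                         centreOut/2
            , toPair   (ll zero (suc (suc zero)) (s≤s z≤n))          pairOverlap/2)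
  , (λ n → potential-hittingTime (TargetPair.potential (suc n))
             (ll (suc (suc zero)) (suc (suc (suc zero))) (s≤s (s≤s (s≤s z≤n))))
             (Values.pairDisjoint/2 (suc n)))
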